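{- Let $D$ be a locatable digraph of order $n$ with $\gamma_{OL}(D)=n$. Then $D$ contains no double-forced vertex.
   Context: Digraphs are finite and may contain loops; for each ordered pair $(x,y)$ there is at most one arc $xy$. $N^-(v)$ is the set of vertices $u$ such that $uv$ is an arc (including $v$ if $v$ has a loop). An OLD set of $D$ is a set $S\subseteq V(D)$ such that every vertex has an in-neighbour in $S$ and for every two distinct vertices $u,v$, some vertex of $S$ lies in $N^-(u)\ominus N^-(v)$ (symmetric difference). $D$ is locatable if it admits an OLD set; $\gamma_{OL}(D)$ is the minimum size of an OLD set. A vertex $v$ is domination-forced if some vertex $w$ has $N^-(w)=\{v\}$; location-forced if there are distinct vertices $x,y$ with $N^-(x)\ominus N^-(y)=\{v\}$. A vertex $v$ is double-forced if either it is both domination-forced and location-forced, or there are two different unordered pairs $\{x,y\}\neq\{x',y'\}$ of distinct vertices with $N^-(x)\ominus N^-(y)=N^-(x')\ominus N^-(y')=\{v\}$. -}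

module Defs where

open import Data.Nat using (ℕ; _≤_)
open import Data.Bool using (Bool; true)
open import Data.Fin using (Fin)
open import Data.Fin.Subset using (Subset; _∈_; ∣_∣)
open import Data.Product using (Σ; ∃; ∃-syntax; _×_)
open import Data.Sum using (_⊎_)
open import Relation.Nullary using (¬_)
open import Relation.Binary.PropositionalEquality using (_≡_; _≢_)

-- A digraph of order n on vertex set Fin n, possibly with loops;
-- arc u v = true iff uv is an arc (so at most one arc per ordered pair).
record Digraph (n : ℕ) : Set where
  field
    arc : Fin n → Fin n → Bool

module _ {n : ℕ} (D : Digraph n) where
  open Digraph D

  InNeg : Fin n → Fin n → Set
  InNeg u v = arc u v ≡ true

  InSymDiff : Fin n → Fin n → Fin n → Set
  InSymDiff x y w = (InNeg w x × ¬ InNeg w y) ⊎ (¬ InNeg w x × InNeg w y)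

  IsOLD : Subset n → Set
  IsOLD S = (∀ v → ∃[ u ] (u ∈ S × InNeg u v))
          × (∀ u v → u ≢ v → ∃[ w ] (w ∈ S × InSymDiff u v w))

  Locatable : Set
  Locatable = ∃[ S ] IsOLD S

  γOL≡ : ℕ → Set
  γOL≡ k = (∃[ S ] (IsOLD S × ∣ S ∣ ≡ k)) × (∀ S → IsOLD S → k ≤ ∣ S ∣)

  NegIsSingleton : Fin n → Fin n → Set
  NegIsSingleton w v = ∀ u → (InNeg u w → u ≡ v) × (u ≡ v → InNeg u w)

  SymDiffIsSingleton : Fin n → Fin n → Fin n → Set
  SymDiffIsSingleton x y v = ∀ u → (InSymDiff x y u → u ≡ v) × (u ≡ v → InSymDiff x y u)

  DominationForced : Fin n → Set
  DominationForced v = ∃[ w ] NegIsSingleton w v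

  LocationForced : Fin n → Set
  LocationForced v = ∃[ x ] ∃[ y ] (x ≢ y × SymDiffIsSingleton x y v)

  SamePair : Fin n → Fin n → Fin n → Fin n → Set
  SamePair x y x' y' = (x ≡ x' × y ≡ y') ⊎ (x ≡ y' × y ≡ x')

  DoubleForced : Fin n → Set
  DoubleForced v =
      (DominationForced v × LocationForced v)
    ⊎ (∃[ x ] ∃[ y ] ∃[ x' ] ∃[ y' ]
         (x ≢ y × x' ≢ y' × ¬ SamePair x y x' y'
          × SymDiffIsSingleton x y v × SymDiffIsSingleton x' y' v))

-- Adjoin the empty set to the in-neighbourhoods of D and view the resulting n + 1
-- sets as vectors in Bool^n. Locatability makes them pairwise distinct, and
-- γ_OL(D) = n means every vertex u is forced (otherwise V ∖ {u} is an OLD set),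
-- i.e. some two of the vectors differ exactly in coordinate u. In a family of
-- vectors in which every coordinate is forced, deleting a forced coordinate u
-- identifies the two vectors forcing it and keeps every other coordinate forced,
-- so the family has more members than coordinates. If u is forced by two pairs
-- that do not share the member to be identified first, a second identification
-- is possible and the family needs at least n + 2 members, one more than there are.
module Submission where

open import Defs
open import Data.Nat using (ℕ; zero; suc; _+_; _<_; s≤s; z≤n)
open import Data.Nat.Properties using (≤-trans; <-irrefl; <⇒≱; +-monoʳ-<; module ≤-Reasoning)
open import Data.Bool using (Bool; true; false)
open import Data.Bool.Properties using (¬-not) renaming (_≟_ to _≟ᵇ_)
open import Data.Fin using (Fin; zero; suc; punchIn)
open import Data.Fin.Properties using (punchIn-injective; punchInᵢ≢i; suc-injective; any?; all?)
  renaming (_≟_ to _≟ᶠ_)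
open import Data.Fin.Subset using (Subset; ⊤; _-_; ∣_∣) renaming (_∈_ to _∈ˢ_)
open import Data.Fin.Subset.Properties
  using (∈⊤; ∣⊤∣≡n; x∈p⇒∣p-x∣<∣p∣; x∈p∧x≢y⇒x∈p-y)
open import Data.Product using (∃-syntax; _×_; _,_; proj₁; proj₂)
open import Data.Sum using (_⊎_; inj₁; inj₂)
open import Function using (_∘_)
open import Relation.Nullary using (¬_; Dec; yes; no; ¬?; contradiction)
open import Relation.Nullary.Decidable using (_×-dec_; _→-dec_)
open import Relation.Binary.PropositionalEquality
  using (_≡_; _≢_; _≗_; refl; sym; trans; cong; subst)

module _ {L : ℕ} where

  DiffersOnlyAt : (g h : Fin L → Bool) → Fin L → Set
  DiffersOnlyAt g h u = g u ≢ h u × (∀ w → w ≢ u → g w ≡ h w)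

  differsOnlyAt? : ∀ g h u → Dec (DiffersOnlyAt g h u)
  differsOnlyAt? g h u =
    ¬? (g u ≟ᵇ h u) ×-dec all? (λ w → ¬? (w ≟ᶠ u) →-dec (g w ≟ᵇ h w))

  differsOnlyAt-sym : ∀ {g h u} → DiffersOnlyAt g h u → DiffersOnlyAt h g u
  differsOnlyAt-sym (gu≢hu , agree) = gu≢hu ∘ sym , λ w w≢u → sym (agree w w≢u)

  differsOnlyAt-resp : ∀ {g g′ h h′ u} → g ≗ g′ → h ≗ h′ →
                       DiffersOnlyAt g h u → DiffersOnlyAt g′ h′ u
  differsOnlyAt-resp {u = u} g≗g′ h≗h′ (gu≢hu , agree) =
    (λ e → gu≢hu (trans (g≗g′ u) (trans e (sym (h≗h′ u))))) ,
    (λ w w≢u → trans (sym (g≗g′ w)) (trans (agree w w≢u) (h≗h′ w)))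

  differsOnlyAt-unique : ∀ {g h h′ u} → DiffersOnlyAt g h u → DiffersOnlyAt g h′ u → h ≗ h′
  differsOnlyAt-unique {u = u} (gu≢hu , agree) (gu≢h′u , agree′) w with w ≟ᶠ u
  ... | yes refl = trans (¬-not (gu≢hu ∘ sym)) (sym (¬-not (gu≢h′u ∘ sym)))
  ... | no w≢u   = trans (sym (agree w w≢u)) (agree′ w w≢u)

  differsOnlyAt⊎differsElsewhere : ∀ {g h w} u → g w ≢ h w →
    DiffersOnlyAt g h u ⊎ ∃[ w′ ] (w′ ≢ u × g w′ ≢ h w′)
  differsOnlyAt⊎differsElsewhere {g} {h} {w} u gw≢hw
    with any? (λ w′ → ¬? (w′ ≟ᶠ u) ×-dec ¬? (g w′ ≟ᵇ h w′))
  ... | yes elsewhere = inj₂ elsewhere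
  ... | no nowhereElse = inj₁ (gu≢hu , agree)
    where
    agree : ∀ w′ → w′ ≢ u → g w′ ≡ h w′
    agree w′ w′≢u with g w′ ≟ᵇ h w′
    ... | yes e = e
    ... | no d  = contradiction (w′ , w′≢u , d) nowhereElse
    gu≢hu : g u ≢ h u
    gu≢hu with w ≟ᶠ u
    ... | yes refl = gw≢hw
    ... | no w≢u   = contradiction (agree w w≢u) gw≢hw

module _ {L : ℕ} {g h : Fin (suc L) → Bool} where

  differsOnlyAt-punchIn : ∀ {u} → DiffersOnlyAt g h u → g ∘ punchIn u ≗ h ∘ punchIn u
  differsOnlyAt-punchIn {u = u} (_ , agree) w = agree (punchIn u w) (punchInᵢ≢i u w)

  differsOnlyAt-restrict : ∀ v u → DiffersOnlyAt g h (punchIn v u) →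
                           DiffersOnlyAt (g ∘ punchIn v) (h ∘ punchIn v) u
  differsOnlyAt-restrict v u (gu≢hu , agree) =
    gu≢hu , λ w w≢u → agree (punchIn v w) (w≢u ∘ punchIn-injective v w u)

module _ {k : ℕ} where

  AllForced : ∀ {L} → (Fin k → Fin L → Bool) → Subset k → Set
  AllForced f S = ∀ u → ∃[ a ] ∃[ b ] (a ∈ˢ S × b ∈ˢ S × DiffersOnlyAt (f a) (f b) u)

  DoublyForced : ∀ {L} → (Fin k → Fin L → Bool) → Fin L → Set
  DoublyForced f u = ∃[ a ] ∃[ b ] ∃[ a′ ] ∃[ b′ ]
    (a′ ≢ a × b′ ≢ a × DiffersOnlyAt (f a) (f b) u × DiffersOnlyAt (f a′) (f b′) u)

  allForced-merge : ∀ {L} {f : Fin k → Fin L → Bool} {S a b} → a ∈ˢ S → b ∈ˢ S → a ≢ b →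
                    f a ≗ f b → AllForced f S → AllForced f (S - a)
  allForced-merge {f = f} {S} {a} {b} a∈S b∈S a≢b fa≗fb forced u
    with forced u
  ... | c , d , c∈S , d∈S , c∣d with representative c∈S | representative d∈S
    where
    representative : ∀ {c} → c ∈ˢ S → ∃[ c′ ] (c′ ∈ˢ S - a × f c′ ≗ f c)
    representative {c} c∈S with c ≟ᶠ a
    ... | yes refl = b , x∈p∧x≢y⇒x∈p-y b∈S (a≢b ∘ sym) , sym ∘ fa≗fb
    ... | no c≢a   = c , x∈p∧x≢y⇒x∈p-y c∈S c≢a , λ _ → refl
  ... | c′ , c′∈ , fc′≗fc | d′ , d′∈ , fd′≗fd =
    c′ , d′ , c′∈ , d′∈ , differsOnlyAt-resp (sym ∘ fc′≗fc) (sym ∘ fd′≗fd) c∣d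

  allForced-restrict : ∀ {L} {f : Fin k → Fin (suc L) → Bool} {S} v →
                       AllForced f S → AllForced (λ c → f c ∘ punchIn v) S
  allForced-restrict v forced u with forced (punchIn v u)
  ... | a , b , a∈S , b∈S , a∣b = a , b , a∈S , b∈S , differsOnlyAt-restrict v u a∣b

  differsOnlyAt⇒≢ : ∀ {L} {f : Fin k → Fin L → Bool} {a b u} →
                    DiffersOnlyAt (f a) (f b) u → a ≢ b
  differsOnlyAt⇒≢ {f = f} {u = u} (fau≢fbu , _) a≡b = fau≢fbu (cong (λ c → f c u) a≡b)

  allForced-contract : ∀ {L} {f : Fin k → Fin (suc L) → Bool} {S a b u} → a ∈ˢ S → b ∈ˢ S →
                       DiffersOnlyAt (f a) (f b) u → AllForced f S →
                       AllForced (λ c → f c ∘ punchIn u) (S - a)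
  allForced-contract {u = u} a∈S b∈S a∣b forced =
    allForced-merge a∈S b∈S (differsOnlyAt⇒≢ a∣b) (differsOnlyAt-punchIn a∣b)
      (allForced-restrict u forced)

  allForced⇒<∣∣ : ∀ {L} {f : Fin k → Fin L → Bool} {S b} → b ∈ˢ S → AllForced f S → L < ∣ S ∣
  allForced⇒<∣∣ {zero} b∈S _ = ≤-trans (s≤s z≤n) (x∈p⇒∣p-x∣<∣p∣ b∈S)
  allForced⇒<∣∣ {suc L} _ forced with forced zero
  ... | a , b , a∈S , b∈S , a∣b =
    ≤-trans (s≤s (allForced⇒<∣∣ b∈S-a (allForced-contract a∈S b∈S a∣b forced)))
            (x∈p⇒∣p-x∣<∣p∣ a∈S)
    where b∈S-a = x∈p∧x≢y⇒x∈p-y b∈S (differsOnlyAt⇒≢ a∣b ∘ sym)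

  doublyForced⇒2+<k : ∀ {L} {f : Fin k → Fin (suc L) → Bool} {u} →
                      AllForced f ⊤ → DoublyForced f u → 2 + L < k
  doublyForced⇒2+<k {L} forced (a , b , a′ , b′ , a′≢a , b′≢a , a∣b , a′∣b′) = begin-strict
    2 + L               <⟨ +-monoʳ-< 2 (allForced⇒<∣∣ b′∈₂ merged) ⟩
    2 + ∣ ⊤ - a - a′ ∣  ≤⟨ s≤s (x∈p⇒∣p-x∣<∣p∣ a′∈₁) ⟩
    1 + ∣ ⊤ - a ∣       ≤⟨ x∈p⇒∣p-x∣<∣p∣ {p = ⊤ {k}} ∈⊤ ⟩
    ∣ ⊤ {k} ∣           ≡⟨ ∣⊤∣≡n k ⟩
    k                   ∎
    where
    open ≤-Reasoning
    a′∈₁ = x∈p∧x≢y⇒x∈p-y ∈⊤ a′≢a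
    b′∈₁ = x∈p∧x≢y⇒x∈p-y ∈⊤ b′≢a
    b′∈₂ = x∈p∧x≢y⇒x∈p-y b′∈₁ (differsOnlyAt⇒≢ a′∣b′ ∘ sym)
    merged = allForced-merge a′∈₁ b′∈₁ (differsOnlyAt⇒≢ a′∣b′) (differsOnlyAt-punchIn a′∣b′)
               (allForced-contract ∈⊤ ∈⊤ a∣b forced)

module _ {n : ℕ} (D : Digraph n) where
  open Digraph D

  -- Index zero stands for the empty set, so that domination-forcing becomes
  -- forcing by a pair of the family.
  N⁻ : Fin (suc n) → Fin n → Bool
  N⁻ zero    _ = false
  N⁻ (suc x) u = arc u x

  symDiff⇒≢ : ∀ {x y w} → InSymDiff D x y w → arc w x ≢ arc w y
  symDiff⇒≢ (inj₁ (wx , ¬wy)) e = ¬wy (trans (sym e) wx)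
  symDiff⇒≢ (inj₂ (¬wx , wy)) e = ¬wx (trans e wy)

  ≢⇒symDiff : ∀ {x y w} → arc w x ≢ arc w y → InSymDiff D x y w
  ≢⇒symDiff {x} {y} {w} d with arc w x | arc w y
  ... | true  | true  = contradiction refl d
  ... | false | false = contradiction refl d
  ... | true  | false = inj₁ (refl , λ ())
  ... | false | true  = inj₂ ((λ ()) , refl)

  N⁻-injective : Locatable D → ∀ a b → N⁻ a ≗ N⁻ b → a ≡ b
  N⁻-injective _ zero zero _ = refl
  N⁻-injective (_ , dominating , _) zero (suc y) eq with dominating y
  ... | u , _ , uy with trans (eq u) uy
  ... | ()
  N⁻-injective (_ , dominating , _) (suc x) zero eq with dominating x
  ... | u , _ , ux with trans (sym (eq u)) ux
  ... | ()
  N⁻-injective (_ , _ , locating) (suc x) (suc y) eq with x ≟ᶠ y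
  ... | yes x≡y = cong suc x≡y
  ... | no x≢y with locating x y x≢y
  ... | w , _ , w∈xy = contradiction (eq w) (symDiff⇒≢ w∈xy)

  dominationForced⇒differsOnlyAt : ∀ {w v} → NegIsSingleton D w v →
                                   DiffersOnlyAt (N⁻ (suc w)) (N⁻ zero) v
  dominationForced⇒differsOnlyAt {w} {v} singleton =
    (λ e → true≢false (trans (sym (proj₂ (singleton v) refl)) e)) , notIn
    where
    true≢false : true ≢ false
    true≢false ()
    notIn : ∀ u → u ≢ v → arc u w ≡ false
    notIn u u≢v with arc u w in uw
    ... | true  = contradiction (proj₁ (singleton u) uw) u≢v
    ... | false = refl

  locationForced⇒differsOnlyAt : ∀ {x y v} → SymDiffIsSingleton D x y v →
                                 DiffersOnlyAt (N⁻ (suc x)) (N⁻ (suc y)) v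
  locationForced⇒differsOnlyAt {x} {y} {v} singleton =
    symDiff⇒≢ (proj₂ (singleton v) refl) , agree
    where
    agree : ∀ u → u ≢ v → arc u x ≡ arc u y
    agree u u≢v with arc u x ≟ᵇ arc u y
    ... | yes e = e
    ... | no d  = contradiction (proj₁ (singleton u) (≢⇒symDiff d)) u≢v

  unforced⇒OLD : Locatable D → ∀ u →
                 ¬ (∃[ a ] ∃[ b ] DiffersOnlyAt (N⁻ a) (N⁻ b) u) → IsOLD D (⊤ - u)
  unforced⇒OLD (_ , dominating , locating) u unforced = dominated , located
    where
    dominated : ∀ y → ∃[ x ] (x ∈ˢ ⊤ - u × InNeg D x y)
    dominated y with dominating y
    ... | w , _ , wy with differsOnlyAt⊎differsElsewhere {g = N⁻ (suc y)} {h = N⁻ zero} u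
                            (λ e → contradiction (trans (sym wy) e) λ ())
    ... | inj₁ forcing            = contradiction (suc y , zero , forcing) unforced
    ... | inj₂ (x , x≢u , x∈N⁻y) = x , x∈p∧x≢y⇒x∈p-y ∈⊤ x≢u , ¬-not x∈N⁻y
    located : ∀ y y′ → y ≢ y′ → ∃[ w ] (w ∈ˢ ⊤ - u × InSymDiff D y y′ w)
    located y y′ y≢y′ with locating y y′ y≢y′
    ... | w , _ , w∈yy′ with differsOnlyAt⊎differsElsewhere u (symDiff⇒≢ w∈yy′)
    ... | inj₁ forcing         = contradiction (suc y , suc y′ , forcing) unforced
    ... | inj₂ (w′ , w′≢u , d) = w′ , x∈p∧x≢y⇒x∈p-y ∈⊤ w′≢u , ≢⇒symDiff d

  γOL≡n⇒allForced : Locatable D → γOL≡ D n → AllForced N⁻ ⊤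
  γOL≡n⇒allForced loc (_ , minimal) u
    with any? (λ a → any? (λ b → differsOnlyAt? (N⁻ a) (N⁻ b) u))
  ... | yes (a , b , a∣b) = a , b , ∈⊤ , ∈⊤ , a∣b
  ... | no unforced =
    contradiction (minimal (⊤ - u) (unforced⇒OLD loc u unforced))
      (<⇒≱ (subst (∣ ⊤ - u ∣ <_) (∣⊤∣≡n n) (x∈p⇒∣p-x∣<∣p∣ {p = ⊤ {n}} ∈⊤)))

  doubleForced⇒doublyForced : Locatable D → ∀ {v} → DoubleForced D v → DoublyForced N⁻ v
  doubleForced⇒doublyForced _ (inj₁ ((w , w⇒v) , (x , y , _ , xy⇒v))) =
    zero , suc w , suc x , suc y , (λ ()) , (λ ()) ,
    differsOnlyAt-sym (dominationForced⇒differsOnlyAt w⇒v) , locationForced⇒differsOnlyAt xy⇒v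
  doubleForced⇒doublyForced loc {v} (inj₂ (x , y , x′ , y′ , _ , _ , distinct , xy⇒v , x′y′⇒v)) =
    suc x , suc y , suc x′ , suc y′ , x′≢x , y′≢x , xy , x′y′
    where
    xy = locationForced⇒differsOnlyAt xy⇒v
    x′y′ = locationForced⇒differsOnlyAt x′y′⇒v
    partner : ∀ {a b c} → DiffersOnlyAt (N⁻ a) (N⁻ b) v → DiffersOnlyAt (N⁻ a) (N⁻ c) v →
              b ≡ c
    partner a∣b a∣c = N⁻-injective loc _ _ (differsOnlyAt-unique a∣b a∣c)
    x′≢x : suc x′ ≢ suc x
    x′≢x refl = distinct (inj₁ (refl , suc-injective (partner xy x′y′)))
    y′≢x : suc y′ ≢ suc x
    y′≢x refl = distinct (inj₂ (refl , suc-injective (partner xy (differsOnlyAt-sym x′y′))))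

proposition2p8 : (n : ℕ) (D : Digraph n) → Locatable D → γOL≡ D n
    → (v : Fin n) → ¬ DoubleForced D v
proposition2p8 zero D loc γ ()
proposition2p8 (suc m) D loc γ v doubleForced =
  <-irrefl refl (doublyForced⇒2+<k (γOL≡n⇒allForced D loc γ)
                                   (doubleForced⇒doublyForced D loc doubleForced))
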